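{- Consider a red/blue coloring of the vertices of the grid $\boxplus_{m\times n}$ that contains a cross-structure. 1. The coloring is not feasible. 2. More precisely, if the two vertices of one color in the cross-structure belong to the same region, then the two vertices of the other color in the cross-structure belong to two different regions, at least one of which is an island.
   Context: - $\boxplus_{m\times n}$ is the $m\times n$ grid graph on vertices $(i,j)$, with edges between vertices at distance $1$. - A partition (coloring) is an assignment of red or blue to every vertex. - A region is a maximal connected set of vertices of the same color. - The coloring (partition) is feasible if it has exactly one red region and exactly one blue region. - An island is a region containing no vertex on the outer boundary of the grid, i.e. all its vertices have degree $4$ in the grid. - A cross-structure is a set of four vertices $(i,j),(i+1,j),(i,j+1),(i+1,j+1)$ in which $(i,j)$ and $(i+1,j+1)$ have one color and $(i+1,j)$ and $(i,j+1)$ have the other color. -}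

module Defs where

open import Data.Nat using (ℕ; zero; suc)
open import Data.Fin using (Fin; toℕ)
open import Data.Product using (_×_; _,_; proj₁; proj₂; ∃)
open import Data.Sum using (_⊎_)
open import Relation.Binary.PropositionalEquality using (_≡_)
open import Relation.Nullary using (¬_)

data Color : Set where
  red blue : Color

Vertex : ℕ → ℕ → Set
Vertex m n = Fin m × Fin n

Coloring : ℕ → ℕ → Set
Coloring m n = Vertex m n → Color

Near : ∀ {k} → Fin k → Fin k → Set
Near a b = suc (toℕ a) ≡ toℕ b ⊎ suc (toℕ b) ≡ toℕ a

Adj : ∀ {m n} → Vertex m n → Vertex m n → Set
Adj u v = (proj₁ u ≡ proj₁ v × Near (proj₂ u) (proj₂ v))
        ⊎ (proj₂ u ≡ proj₂ v × Near (proj₁ u) (proj₁ v))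

data MonoPath {m n} (c : Coloring m n) (col : Color) : Vertex m n → Vertex m n → Set where
  here : ∀ {u} → c u ≡ col → MonoPath c col u u
  step : ∀ {u w v} → c u ≡ col → Adj u w → MonoPath c col w v → MonoPath c col u v

SameRegion : ∀ {m n} → Coloring m n → Vertex m n → Vertex m n → Set
SameRegion c u v = MonoPath c (c u) u v

ExactlyOneRegion : ∀ {m n} → Coloring m n → Color → Set
ExactlyOneRegion {m} {n} c col =
  ∃ (λ (u : Vertex m n) → c u ≡ col)
  × (∀ (u v : Vertex m n) → c u ≡ col → c v ≡ col → SameRegion c u v)

Feasible : ∀ {m n} → Coloring m n → Set
Feasible c = ExactlyOneRegion c red × ExactlyOneRegion c blue

OnBoundary : ∀ {m n} → Vertex m n → Set
OnBoundary {m} {n} (i , j) =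
  toℕ i ≡ 0 ⊎ suc (toℕ i) ≡ m ⊎ toℕ j ≡ 0 ⊎ suc (toℕ j) ≡ n

IsIsland : ∀ {m n} → Coloring m n → Vertex m n → Set
IsIsland c u = ∀ v → SameRegion c u v → ¬ OnBoundary v

Cross : ∀ {m n} → Coloring m n → Fin m → Fin m → Fin n → Fin n → Set
Cross c i i' j j' =
  toℕ i' ≡ suc (toℕ i) × toℕ j' ≡ suc (toℕ j)
  × c (i , j) ≡ c (i' , j') × c (i' , j) ≡ c (i , j')
  × ¬ (c (i , j) ≡ c (i' , j))

{-# OPTIONS --safe #-}
-- A Jordan-curve parity argument.  Suppose two opposite corners of the cross have color A and
-- are joined by a path of color A.  Closing that path with the diagonal of the cross square
-- gives a closed curve; give every lattice point the parity of the number of times the curve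
-- crosses a vertical ray going up from the point.  This parity cannot change between adjacent
-- points off the curve and vanishes outside the grid, but it differs at the other two corners of
-- the cross, which the diagonal separates.  So those two corners lie in different regions, and
-- the region of the odd one never reaches the boundary.  A feasible coloring would have each
-- pair of equally colored corners in one region, which is impossible.
module Submission where

open import Defs
open import Algebra.Bundles using (CommutativeRing)
open import Data.Bool using (Bool; true; false; T; _∧_; _xor_)
open import Data.Bool.Properties
  using (∧-zeroʳ; xor-assoc; xor-comm; xor-same; xor-∧-commutativeRing)
open import Algebra.Properties.CommutativeSemigroup
  (CommutativeRing.+-commutativeSemigroup xor-∧-commutativeRing)
  using () renaming (interchange to xor-interchange)
open import Data.Nat using (ℕ; zero; suc; _≤_; z≤n; s≤s; _<ᵇ_; _≡ᵇ_)
open import Data.Nat.Properties using (suc-injective; <-irrefl; ≤-refl; n≤1+n; ≡ᵇ⇒≡)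
open import Data.Fin using (Fin; toℕ)
open import Data.Fin.Properties using (toℕ-injective; toℕ<n)
open import Data.Product using (_×_; _,_; proj₁; proj₂; ∃)
open import Data.Sum as Sum using (_⊎_; inj₁; inj₂)
open import Function using (_∘_)
open import Relation.Nullary using (¬_; contradiction)
open import Relation.Binary.Construct.Closure.Symmetric using (SymClosure; fwd; bwd)
open import Relation.Binary.PropositionalEquality
  using (_≡_; _≢_; refl; sym; trans; cong; cong₂; subst; module ≡-Reasoning)

open ≡-Reasoning

xor-cancel-middle : ∀ x y z → (x xor y) xor (y xor z) ≡ x xor z
xor-cancel-middle x y z = begin
  (x xor y) xor (y xor z)  ≡⟨ xor-assoc x y (y xor z) ⟩
  x xor (y xor (y xor z))  ≡⟨ cong (x xor_) (xor-assoc y y z) ⟨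
  x xor ((y xor y) xor z)  ≡⟨ cong (λ t → x xor (t xor z)) (xor-same y) ⟩
  x xor z                  ∎

xor≡false⇒≡ : ∀ {x y} → x xor y ≡ false → x ≡ y
xor≡false⇒≡ {false} {false} _ = refl
xor≡false⇒≡ {true}  {true}  _ = refl

≡⇒xor≡false : ∀ {x y} → x ≡ y → x xor y ≡ false
≡⇒xor≡false {x} refl = xor-same x

xor≡true⇒≢ : ∀ {x y} → x xor y ≡ true → x ≢ y
xor≡true⇒≢ {false} () refl
xor≡true⇒≢ {true}  () refl

xor≡true⇒⊎ : ∀ {x y} → x xor y ≡ true → x ≡ true ⊎ y ≡ true
xor≡true⇒⊎ {true}  _   = inj₁ refl
xor≡true⇒⊎ {false} odd = inj₂ odd

∧-congˡ-under : ∀ g {x y} → (T g → x ≡ y) → g ∧ x ≡ g ∧ y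
∧-congˡ-under false _   = refl
∧-congˡ-under true  x≡y = x≡y _

≡ᵇ-refl : ∀ n → (n ≡ᵇ n) ≡ true
≡ᵇ-refl zero    = refl
≡ᵇ-refl (suc n) = ≡ᵇ-refl n

n≢ᵇ1+n : ∀ n → (n ≡ᵇ suc n) ≡ false
n≢ᵇ1+n zero    = refl
n≢ᵇ1+n (suc n) = n≢ᵇ1+n n

n<ᵇ1+n : ∀ n → (n <ᵇ suc n) ≡ true
n<ᵇ1+n zero    = refl
n<ᵇ1+n (suc n) = n<ᵇ1+n n

≤⇒≮ᵇ : ∀ {a r} → a ≤ r → (r <ᵇ a) ≡ false
≤⇒≮ᵇ z≤n       = refl
≤⇒≮ᵇ (s≤s a≤r) = ≤⇒≮ᵇ a≤r

<ᵇ-sucʳ : ∀ {r a} → r ≢ a → (r <ᵇ a) ≡ (r <ᵇ suc a)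
<ᵇ-sucʳ {zero}  {zero}  r≢a = contradiction refl r≢a
<ᵇ-sucʳ {zero}  {suc a} _   = refl
<ᵇ-sucʳ {suc r} {zero}  _   = refl
<ᵇ-sucʳ {suc r} {suc a} r≢a = <ᵇ-sucʳ (r≢a ∘ cong suc)

<ᵇ-sucˡ : ∀ {r a} → suc r ≢ a → (r <ᵇ a) ≡ (suc r <ᵇ a)
<ᵇ-sucˡ {r}     {zero}        _   = refl
<ᵇ-sucˡ {zero}  {suc zero}    r≢a = contradiction refl r≢a
<ᵇ-sucˡ {zero}  {suc (suc a)} _   = refl
<ᵇ-sucˡ {suc r} {suc a}       r≢a = <ᵇ-sucˡ (r≢a ∘ cong suc)

Point : Set
Point = ℕ × ℕ

data Edge : Point → Point → Set where
  hor : ∀ {a b} → Edge (a , b) (a , suc b)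
  ver : ∀ {a b} → Edge (a , b) (suc a , b)

horizontal : ∀ {a b b'} → suc b ≡ b' → Edge (a , b) (a , b')
horizontal refl = hor

vertical : ∀ {a a' b} → suc a ≡ a' → Edge (a , b) (a' , b)
vertical refl = ver

Step : Point → Point → Set
Step = SymClosure Edge

data Path (O : Point → Set) : Point → Point → Set where
  here : ∀ {p} → O p → Path O p p
  step : ∀ {p q r} → O p → Step p q → Path O q r → Path O p r

EdgeWeight : Set
EdgeWeight = ∀ {p q} → Edge p q → Bool

_⊕_ : EdgeWeight → EdgeWeight → EdgeWeight
(w₁ ⊕ w₂) d = w₁ d xor w₂ d

stepWeight : EdgeWeight → ∀ {p q} → Step p q → Bool
stepWeight w (fwd d) = w d
stepWeight w (bwd d) = w d

module _ {O : Point → Set} where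

  source : ∀ {p q} → Path O p q → O p
  source (here p∈O)     = p∈O
  source (step p∈O _ _) = p∈O

  target : ∀ {p q} → Path O p q → O q
  target (here q∈O)   = q∈O
  target (step _ _ P) = target P

  xorSum : EdgeWeight → ∀ {s e} → Path O s e → Bool
  xorSum w (here _)      = false
  xorSum w (step _ st P) = stepWeight w st xor xorSum w P

  xorSum-coboundary : ∀ (w : EdgeWeight) (g : Point → Bool) →
    (∀ {p q} → O p → O q → (d : Edge p q) → w d ≡ g p xor g q) →
    ∀ {s e} (P : Path O s e) → xorSum w P ≡ g s xor g e
  xorSum-coboundary w g δ (here {p} _) = sym (xor-same (g p))
  xorSum-coboundary w g δ (step {p} {q} {r} p∈O st P) = begin
    stepWeight w st xor xorSum w P   ≡⟨ cong₂ _xor_ (coboundary st) (xorSum-coboundary w g δ P) ⟩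
    (g p xor g q) xor (g q xor g r)  ≡⟨ xor-cancel-middle (g p) (g q) (g r) ⟩
    g p xor g r                      ∎
    where
    coboundary : (st : Step p q) → stepWeight w st ≡ g p xor g q
    coboundary (fwd d) = δ p∈O (source P) d
    coboundary (bwd d) = trans (δ (source P) p∈O d) (xor-comm (g q) (g p))

  stepWeight-⊕ : ∀ (w₁ w₂ : EdgeWeight) {p q} (st : Step p q) →
    stepWeight (w₁ ⊕ w₂) st ≡ stepWeight w₁ st xor stepWeight w₂ st
  stepWeight-⊕ w₁ w₂ (fwd d) = refl
  stepWeight-⊕ w₁ w₂ (bwd d) = refl

  xorSum-⊕ : ∀ (w₁ w₂ : EdgeWeight) {s e} (P : Path O s e) →
    xorSum (w₁ ⊕ w₂) P ≡ xorSum w₁ P xor xorSum w₂ P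
  xorSum-⊕ w₁ w₂ (here _)      = refl
  xorSum-⊕ w₁ w₂ (step _ st P) = begin
    stepWeight (w₁ ⊕ w₂) st xor xorSum (w₁ ⊕ w₂) P
      ≡⟨ cong₂ _xor_ (stepWeight-⊕ w₁ w₂ st) (xorSum-⊕ w₁ w₂ P) ⟩
    (stepWeight w₁ st xor stepWeight w₂ st) xor (xorSum w₁ P xor xorSum w₂ P)
      ≡⟨ xor-interchange (stepWeight w₁ st) (stepWeight w₂ st) (xorSum w₁ P) (xorSum w₂ P) ⟩
    (stepWeight w₁ st xor xorSum w₁ P) xor (stepWeight w₂ st xor xorSum w₂ P) ∎

-- The ray of x = (a , b) is the upward vertical half-line starting at (a , b + ½).  It meets no
-- lattice point and no vertical edge, and it crosses the horizontal edge (r , k) — (r , k + 1)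
-- exactly when (r , k) lies strictly above x in the same column, which is what onRay x tests.
onRay : Point → Point → Bool
onRay (a , b) (r , k) = (k ≡ᵇ b) ∧ (r <ᵇ a)

crossesRay : Point → EdgeWeight
crossesRay x (hor {a} {b}) = onRay x (a , b)
crossesRay x ver           = false

onRay-extend : ∀ {a b r k} → (k ≡ b → r ≢ a) →
  onRay (a , b) (r , k) ≡ onRay (suc a , b) (r , k)
onRay-extend {b = b} {k = k} r≢a = ∧-congˡ-under (k ≡ᵇ b) (<ᵇ-sucʳ ∘ r≢a ∘ ≡ᵇ⇒≡ k b)

onRay-descend : ∀ {a b r k} → (k ≡ b → suc r ≢ a) →
  onRay (a , b) (r , k) ≡ onRay (a , b) (suc r , k)
onRay-descend {b = b} {k = k} r≢a = ∧-congˡ-under (k ≡ᵇ b) (<ᵇ-sucˡ ∘ r≢a ∘ ≡ᵇ⇒≡ k b)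

onRay-not-above : ∀ {a b r k} → a ≤ r → onRay (a , b) (r , k) ≡ false
onRay-not-above {b = b} {k = k} a≤r = trans (cong ((k ≡ᵇ b) ∧_) (≤⇒≮ᵇ a≤r)) (∧-zeroʳ _)

onRay-above : ∀ a b → onRay (suc a , b) (a , b) ≡ true
onRay-above a b = cong₂ _∧_ (≡ᵇ-refl b) (n<ᵇ1+n a)

onRay-left : ∀ a b r → onRay (a , suc b) (r , b) ≡ false
onRay-left a b r = cong (_∧ (r <ᵇ a)) (n≢ᵇ1+n b)

module _ {O : Point → Set} {s e : Point} (P : Path O s e) where

  crossings : Point → Bool
  crossings x = xorSum (crossesRay x) P

  crossings-shift-down : ∀ {a b} → ¬ (O (a , b) × O (a , suc b)) →
    crossings (a , b) ≡ crossings (suc a , b)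
  crossings-shift-down {a} {b} edge∉O =
    xor≡false⇒≡ (trans (sym (xorSum-⊕ _ _ P)) (xorSum-coboundary _ (λ _ → false) δ P))
    where
    δ : ∀ {p q} → O p → O q → (d : Edge p q) →
      (crossesRay (a , b) ⊕ crossesRay (suc a , b)) d ≡ false
    δ p∈O q∈O (hor {r} {k}) = ≡⇒xor≡false (onRay-extend {a} {b} {r} {k} λ k≡b r≡a →
      edge∉O (subst O (cong₂ _,_ r≡a k≡b) p∈O , subst O (cong₂ _,_ r≡a (cong suc k≡b)) q∈O))
    δ _ _ ver = refl

  -- The rays of (a , b) and (a , b + 1) differ by the coboundary of onRay (a , b + 1), except on
  -- the vertical edge entering (a , b + 1) from above; so only the two ends of P contribute.
  crossings-shift-right : ∀ {a b} → ¬ O (a , suc b) →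
    crossings (a , b) xor crossings (a , suc b) ≡ onRay (a , suc b) s xor onRay (a , suc b) e
  crossings-shift-right {a} {b} y∉O =
    trans (sym (xorSum-⊕ _ _ P)) (xorSum-coboundary _ (onRay (a , suc b)) δ P)
    where
    δ : ∀ {p q} → O p → O q → (d : Edge p q) →
      (crossesRay (a , b) ⊕ crossesRay (a , suc b)) d ≡ onRay (a , suc b) p xor onRay (a , suc b) q
    δ _ _ (hor {r} {k}) = xor-comm (onRay (a , b) (r , k)) (onRay (a , suc b) (r , k))
    δ _ q∈O (ver {r} {k}) = sym (≡⇒xor≡false (onRay-descend {a} {suc b} {r} {k}
      λ k≡1+b 1+r≡a → y∉O (subst O (cong₂ _,_ 1+r≡a k≡1+b) q∈O)))

data Diagonal : Point → Point → Point → Set where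
  main : ∀ {a b} → Diagonal (a , b) (a , b) (suc a , suc b)
  anti : ∀ {a b} → Diagonal (a , b) (suc a , b) (a , suc b)

data Square : Point → Point → Point → Point → Set where
  square : ∀ {a b} → Square (a , b) (a , suc b) (suc a , b) (suc a , suc b)

mainDiagonal : ∀ {tl tr bl br} → Square tl tr bl br → Diagonal tl tl br
mainDiagonal square = main

antiDiagonal : ∀ {tl tr bl br} → Square tl tr bl br → Diagonal tl bl tr
antiDiagonal square = anti

onRay-diagonal-right : ∀ {q s e a b} → Diagonal q s e → (a , suc b) ≢ s → (a , suc b) ≢ e →
  onRay (a , suc b) s xor onRay (a , suc b) e ≡ onRay (a , b) q xor onRay (a , suc b) q
onRay-diagonal-right {a = a} {b} (main {I} {J}) _ y≢e =
  trans (cong (onRay (a , suc b) (I , J) xor_) (sym (onRay-descend λ J≡b 1+I≡a →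
    y≢e (cong₂ _,_ (sym 1+I≡a) (cong suc (sym J≡b))))))
    (xor-comm (onRay (a , suc b) (I , J)) (onRay (a , b) (I , J)))
onRay-diagonal-right {a = a} {b} (anti {I} {J}) y≢s _ =
  trans (cong (_xor onRay (a , b) (I , J)) (sym (onRay-descend λ J≡1+b 1+I≡a →
    y≢s (cong₂ _,_ (sym 1+I≡a) (sym J≡1+b)))))
    (xor-comm (onRay (a , suc b) (I , J)) (onRay (a , b) (I , J)))

onRay-diagonal-down : ∀ {q s e a b} → Diagonal q s e → (a , b) ≢ s → (suc a , b) ≢ s →
  onRay (a , b) q ≡ onRay (suc a , b) q
onRay-diagonal-down main x≢s _ = onRay-extend λ J≡b I≡a → x≢s (cong₂ _,_ (sym I≡a) (sym J≡b))
onRay-diagonal-down anti _ y≢s =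
  onRay-extend λ J≡b I≡a → y≢s (cong₂ _,_ (cong suc (sym I≡a)) (sym J≡b))

module Curve {O : Point → Set} {q s e : Point} (P : Path O s e) (d : Diagonal q s e) where

  -- Crossing parity of the closed curve formed by P and the diagonal d of the square with corner
  -- q: the diagonal meets the ray of x exactly when q is on that ray.
  parity : Point → Bool
  parity x = crossings P x xor onRay x q

  parity-xor : ∀ x y →
    parity x xor parity y ≡ (crossings P x xor crossings P y) xor (onRay x q xor onRay y q)
  parity-xor x y = xor-interchange (crossings P x) (onRay x q) (crossings P y) (onRay y q)

  private
    avoids : ∀ {x p} → ¬ O x → O p → x ≢ p
    avoids x∉O p∈O refl = x∉O p∈O

  parity-edge : ∀ {x y} → Edge x y → ¬ O x → ¬ O y → parity x ≡ parity y
  parity-edge {x} {y} hor _ y∉O = xor≡false⇒≡ (begin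
    parity x xor parity y
      ≡⟨ parity-xor x y ⟩
    (crossings P x xor crossings P y) xor (onRay x q xor onRay y q)
      ≡⟨ cong (_xor _) (crossings-shift-right P y∉O) ⟩
    (onRay y s xor onRay y e) xor (onRay x q xor onRay y q)
      ≡⟨ cong (_xor _) (onRay-diagonal-right d (avoids y∉O (source P)) (avoids y∉O (target P))) ⟩
    (onRay x q xor onRay y q) xor (onRay x q xor onRay y q)
      ≡⟨ xor-same (onRay x q xor onRay y q) ⟩
    false ∎)
  parity-edge ver x∉O y∉O =
    cong₂ _xor_ (crossings-shift-down P (x∉O ∘ proj₁))
                (onRay-diagonal-down d (avoids x∉O (source P)) (avoids y∉O (source P)))

  parity-step : ∀ {x y} → Step x y → ¬ O x → ¬ O y → parity x ≡ parity y
  parity-step (fwd d) x∉O y∉O = parity-edge d x∉O y∉O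
  parity-step (bwd d) x∉O y∉O = sym (parity-edge d y∉O x∉O)

  parity-top : ∀ b → parity (0 , b) ≡ false
  parity-top b = cong₂ _xor_ (xorSum-coboundary _ (λ _ → false) top P) (∧-zeroʳ _)
    where
    top : ∀ {p q} → O p → O q → (d : Edge p q) → crossesRay (0 , b) d ≡ false
    top _ _ hor = ∧-zeroʳ _
    top _ _ ver = refl

  parity-column : ∀ {b} → (∀ r → ¬ O (r , b)) → ∀ a → parity (a , b) ≡ parity (0 , b)
  parity-column column∉O zero    = refl
  parity-column column∉O (suc a) =
    trans (sym (parity-edge ver (column∉O a) (column∉O (suc a)))) (parity-column column∉O a)

  parity-row : ∀ {a} → (∀ k → ¬ O (a , k)) → ∀ b → parity (a , b) ≡ parity (a , 0)
  parity-row row∉O zero    = refl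
  parity-row row∉O (suc b) =
    trans (sym (parity-edge hor (row∉O b) (row∉O (suc b)))) (parity-row row∉O b)

parity-main-diagonal : ∀ {O tl tr bl br} (sq : Square tl tr bl br) (P : Path O tl br) → ¬ O tr →
  Curve.parity P (mainDiagonal sq) bl xor Curve.parity P (mainDiagonal sq) tr ≡ true
parity-main-diagonal (square {a} {b}) P tr∉O = begin
  parity (suc a , b) xor parity (a , suc b)
    ≡⟨ parity-xor (suc a , b) (a , suc b) ⟩
  (crossings P (suc a , b) xor crossings P (a , suc b))
    xor (onRay (suc a , b) (a , b) xor onRay (a , suc b) (a , b))
    ≡⟨ cong₂ (λ c t → (c xor crossings P (a , suc b)) xor t)
             (sym (crossings-shift-down P (tr∉O ∘ proj₂)))
             (cong₂ _xor_ (onRay-above a b) (onRay-left a b a)) ⟩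
  (crossings P (a , b) xor crossings P (a , suc b)) xor true
    ≡⟨ cong (_xor true) (crossings-shift-right P tr∉O) ⟩
  (onRay (a , suc b) (a , b) xor onRay (a , suc b) (suc a , suc b)) xor true
    ≡⟨ cong₂ (λ u v → (u xor v) xor true)
             (onRay-left a b a) (onRay-not-above {b = suc b} {k = suc b} (n≤1+n a)) ⟩
  true ∎
  where open Curve P main

parity-anti-diagonal : ∀ {O tl tr bl br} (sq : Square tl tr bl br) (P : Path O bl tr) →
  ¬ O tl → ¬ O br →
  Curve.parity P (antiDiagonal sq) tl xor Curve.parity P (antiDiagonal sq) br ≡ true
parity-anti-diagonal (square {a} {b}) P tl∉O br∉O = begin
  parity (a , b) xor parity (suc a , suc b)
    ≡⟨ parity-xor (a , b) (suc a , suc b) ⟩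
  (crossings P (a , b) xor crossings P (suc a , suc b))
    xor (onRay (a , b) (a , b) xor onRay (suc a , suc b) (a , b))
    ≡⟨ cong₂ (λ c t → (c xor crossings P (suc a , suc b)) xor t)
             (crossings-shift-down P (tl∉O ∘ proj₁))
             (cong₂ _xor_ (onRay-not-above {a} {b} {a} {b} ≤-refl) (onRay-left (suc a) b a)) ⟩
  (crossings P (suc a , b) xor crossings P (suc a , suc b)) xor false
    ≡⟨ cong (_xor false) (crossings-shift-right P br∉O) ⟩
  (onRay (suc a , suc b) (suc a , b) xor onRay (suc a , suc b) (a , suc b)) xor false
    ≡⟨ cong₂ (λ u v → (u xor v) xor false)
             (onRay-left (suc a) b (suc a)) (onRay-above a (suc b)) ⟩
  true ∎
  where open Curve P anti

-- The grid is placed in ℕ × ℕ shifted by one, so that it is surrounded by a frame of lattice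
-- points (rows 0 and m + 1, columns 0 and n + 1) through which no grid path passes.
embed : ∀ {m n} → Vertex m n → Point
embed (i , j) = suc (toℕ i) , suc (toℕ j)

embed-injective : ∀ {m n} {u v : Vertex m n} → embed u ≡ embed v → u ≡ v
embed-injective eq = cong₂ _,_ (toℕ-injective (suc-injective (cong proj₁ eq)))
                               (toℕ-injective (suc-injective (cong proj₂ eq)))

adj⇒step : ∀ {m n} {u v : Vertex m n} → Adj u v → Step (embed u) (embed v)
adj⇒step {u = _ , _} {_ , _} (inj₁ (refl , inj₁ 1+j≡j')) = fwd (horizontal (cong suc 1+j≡j'))
adj⇒step {u = _ , _} {_ , _} (inj₁ (refl , inj₂ 1+j'≡j)) = bwd (horizontal (cong suc 1+j'≡j))
adj⇒step {u = _ , _} {_ , _} (inj₂ (refl , inj₁ 1+i≡i')) = fwd (vertical (cong suc 1+i≡i'))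
adj⇒step {u = _ , _} {_ , _} (inj₂ (refl , inj₂ 1+i'≡i)) = bwd (vertical (cong suc 1+i'≡i))

cross-square : ∀ {m n} {c : Coloring m n} {i i' j j'} → Cross c i i' j j' →
  Square (embed (i , j)) (embed (i , j')) (embed (i' , j)) (embed (i' , j'))
cross-square (i'≡1+i , j'≡1+j , _) rewrite i'≡1+i | j'≡1+j = square

module _ {m n} {c : Coloring m n} where

  color-first : ∀ {B u v} → MonoPath c B u v → c u ≡ B
  color-first (here u∈B)     = u∈B
  color-first (step u∈B _ _) = u∈B

  color-last : ∀ {B u v} → MonoPath c B u v → c v ≡ B
  color-last (here v∈B)   = v∈B
  color-last (step _ _ P) = color-last P

  feasible-connected : Feasible c → ∀ {u v} → c u ≡ c v → SameRegion c u v
  feasible-connected (reds , blues) {u} {v} u~v = connect (c u) refl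
    where
    connect : ∀ B → c u ≡ B → SameRegion c u v
    connect red  u∈B = proj₂ reds  u v u∈B (trans (sym u~v) u∈B)
    connect blue u∈B = proj₂ blues u v u∈B (trans (sym u~v) u∈B)

module Grid {m n} (c : Coloring m n) (A : Color) where

  Occupied : Point → Set
  Occupied p = ∃ λ v → c v ≡ A × embed v ≡ p

  unoccupied : ∀ {v} → ¬ c v ≡ A → ¬ Occupied (embed v)
  unoccupied v∉A (w , w∈A , eq) = v∉A (subst (λ u → c u ≡ A) (embed-injective eq) w∈A)

  toPath : ∀ {u v} → MonoPath c A u v → Path Occupied (embed u) (embed v)
  toPath (here u∈A)       = here (_ , u∈A , refl)
  toPath (step u∈A adj P) = step (_ , u∈A , refl) (adj⇒step adj) (toPath P)

  top-unoccupied : ∀ k → ¬ Occupied (0 , k)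
  top-unoccupied k (_ , _ , ())

  left-unoccupied : ∀ r → ¬ Occupied (r , 0)
  left-unoccupied r (_ , _ , ())

  bottom-unoccupied : ∀ k → ¬ Occupied (suc m , k)
  bottom-unoccupied k ((i , _) , _ , eq) = <-irrefl (suc-injective (cong proj₁ eq)) (toℕ<n i)

  right-unoccupied : ∀ r → ¬ Occupied (r , suc n)
  right-unoccupied r ((_ , j) , _ , eq) = <-irrefl (suc-injective (cong proj₂ eq)) (toℕ<n j)

  module Separation {q s e : Point} (P : Path Occupied s e) (d : Diagonal q s e) where
    open Curve P d public

    parity-left : ∀ a → parity (a , 0) ≡ false
    parity-left a = trans (parity-column left-unoccupied a) (parity-top 0)

    parity-right : ∀ a → parity (a , suc n) ≡ false
    parity-right a = trans (parity-column right-unoccupied a) (parity-top (suc n))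

    parity-bottom : ∀ b → parity (suc m , b) ≡ false
    parity-bottom b = trans (parity-row bottom-unoccupied b) (parity-left (suc m))

    parity-boundary : ∀ {v} → ¬ c v ≡ A → OnBoundary v → parity (embed v) ≡ false
    parity-boundary v∉A (inj₁ i≡0) =
      trans (sym (parity-edge (vertical (cong suc (sym i≡0)))
                              (top-unoccupied _) (unoccupied v∉A)))
            (parity-top _)
    parity-boundary v∉A (inj₂ (inj₁ 1+i≡m)) =
      trans (parity-edge (vertical (cong suc 1+i≡m)) (unoccupied v∉A) (bottom-unoccupied _))
            (parity-bottom _)
    parity-boundary v∉A (inj₂ (inj₂ (inj₁ j≡0))) =
      trans (sym (parity-edge (horizontal (cong suc (sym j≡0)))
                              (left-unoccupied _) (unoccupied v∉A)))
            (parity-left _)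
    parity-boundary v∉A (inj₂ (inj₂ (inj₂ 1+j≡n))) =
      trans (parity-edge (horizontal (cong suc 1+j≡n)) (unoccupied v∉A) (right-unoccupied _))
            (parity-right _)

    parity-region : ∀ {B u v} → ¬ B ≡ A → MonoPath c B u v → parity (embed u) ≡ parity (embed v)
    parity-region B≢A (here _) = refl
    parity-region {B} B≢A (step u∈B adj P) =
      trans (parity-step (adj⇒step adj) (off u∈B) (off (color-first P))) (parity-region B≢A P)
      where
      off : ∀ {w} → c w ≡ B → ¬ Occupied (embed w)
      off w∈B = unoccupied (B≢A ∘ trans (sym w∈B))

    odd⇒island : ∀ {u} → ¬ c u ≡ A → parity (embed u) ≡ true → IsIsland c u
    odd⇒island {u} u∉A odd v u~v v∈∂ = contradiction (begin
      true               ≡⟨ odd ⟨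
      parity (embed u)   ≡⟨ parity-region u∉A u~v ⟩
      parity (embed v)   ≡⟨ parity-boundary (u∉A ∘ trans (sym (color-last u~v))) v∈∂ ⟩
      false              ∎) λ ()

    separated : ∀ {x y} → ¬ c x ≡ A → c x ≡ c y → parity (embed x) xor parity (embed y) ≡ true →
      ¬ SameRegion c x y × (IsIsland c x ⊎ IsIsland c y)
    separated x∉A x~y odd =
      xor≡true⇒≢ odd ∘ parity-region x∉A ,
      Sum.map (odd⇒island x∉A) (odd⇒island (x∉A ∘ trans x~y)) (xor≡true⇒⊎ odd)

cross-main : ∀ {m n} (c : Coloring m n) {i i' j j'} → Cross c i i' j j' →
  SameRegion c (i , j) (i' , j') →
  ¬ SameRegion c (i' , j) (i , j') × (IsIsland c (i' , j) ⊎ IsIsland c (i , j'))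
cross-main c {i} {j = j} cross@(_ , _ , _ , c₂ , c₃) P =
  separated (c₃ ∘ sym) c₂
    (parity-main-diagonal (cross-square cross) (toPath P) (unoccupied (c₃ ∘ sym ∘ trans c₂)))
  where
  open Grid c (c (i , j))
  open Separation (toPath P) (mainDiagonal (cross-square cross))

cross-anti : ∀ {m n} (c : Coloring m n) {i i' j j'} → Cross c i i' j j' →
  SameRegion c (i' , j) (i , j') →
  ¬ SameRegion c (i , j) (i' , j') × (IsIsland c (i , j) ⊎ IsIsland c (i' , j'))
cross-anti c {i' = i'} {j} cross@(_ , _ , c₁ , _ , c₃) P =
  separated c₃ c₁
    (parity-anti-diagonal (cross-square cross) (toPath P)
                          (unoccupied c₃) (unoccupied (c₃ ∘ trans c₁)))
  where
  open Grid c (c (i' , j))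
  open Separation (toPath P) (antiDiagonal (cross-square cross))

lemma19 : (m n : ℕ) (c : Coloring m n) (i i' : Fin m) (j j' : Fin n) →
    Cross c i i' j j' →
    ¬ Feasible c
    × (SameRegion c (i , j) (i' , j') →
         ¬ SameRegion c (i' , j) (i , j')
         × (IsIsland c (i' , j) ⊎ IsIsland c (i , j')))
    × (SameRegion c (i' , j) (i , j') →
         ¬ SameRegion c (i , j) (i' , j')
         × (IsIsland c (i , j) ⊎ IsIsland c (i' , j')))
lemma19 m n c i i' j j' cross@(_ , _ , c₁ , c₂ , _) =
  not-feasible , cross-main c cross , cross-anti c cross
  where
  not-feasible : ¬ Feasible c
  not-feasible F =
    proj₁ (cross-main c cross (feasible-connected F c₁)) (feasible-connected F c₂)
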